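{- Let $G$ be a connected strongly regular graph with parameters $(n,k,2,\mu)$, with $k\geq 3$, such that each vertex of $G$ is the central vertex of exactly one wheel in $G$. Then the anti-Gallai graph $\Delta(G)$ is connected and edge-regular.
   Context: All graphs are finite and simple. A $k$-regular graph $G$ on $n$ vertices is strongly regular with parameters $(n,k,\lambda,\mu)$ if $G$ is neither complete nor empty, any two adjacent vertices have exactly $\lambda$ common neighbours, and any two non-adjacent vertices have exactly $\mu$ common neighbours. An edge-regular graph with parameters $(n,k,\lambda)$ is a $k$-regular graph on $n$ vertices in which any two adjacent vertices have exactly $\lambda$ common neighbours. The wheel $W_m$ is obtained by joining a central vertex to all vertices of a cycle $C_m$; a wheel in $G$ with central vertex $u$ is a (not necessarily induced) subgraph of $G$ isomorphic to some $W_m$ with $u$ as centre. The anti-Gallai graph $\Delta(G)$ has the edges of $G$ as vertices, two being adjacent iff the corresponding edges lie on a common triangle of $G$. -}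

module Defs where

open import Data.Nat using (ℕ; zero; suc; _≤_; _<ᵇ_)
open import Data.Fin using (Fin; toℕ)
open import Data.Fin.Properties using (_≟_)
open import Data.Bool using (Bool; true; false; _∧_; _∨_; not; if_then_else_)
open import Data.List using (List; []; _∷_; map; concatMap; filterᵇ; length)
open import Data.Bool.ListAction using (any)
open import Data.List.Membership.Propositional using (_∈_)
open import Data.Product using (Σ; ∃; _×_; _,_)
open import Data.Sum using (_⊎_)
open import Data.List using () renaming (allFin to allFinL)
open import Relation.Nullary using (¬_)
open import Relation.Nullary.Decidable using (⌊_⌋)
open import Relation.Binary.PropositionalEquality using (_≡_)

-- Generic finite graph given by a vertex list (duplicate-free, listing
-- all vertices) and a Bool-valued adjacency.

cnt : {V : Set} → (V → Bool) → List V → ℕ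
cnt p []       = 0
cnt p (x ∷ xs) = if p x then suc (cnt p xs) else cnt p xs

module GraphNotions {V : Set} (vs : List V) (A : V → V → Bool) where

  degree : V → ℕ
  degree v = cnt (A v) vs

  common : V → V → ℕ
  common v w = cnt (λ x → A v x ∧ A w x) vs

  data Reach : V → V → Set where
    here : ∀ {v} → Reach v v
    step : ∀ {u v w} → v ∈ vs → A u v ≡ true → Reach v w → Reach u w

  Connected : Set
  Connected = ∀ v w → v ∈ vs → w ∈ vs → Reach v w

  Regular : ℕ → Set
  Regular k = ∀ v → v ∈ vs → degree v ≡ k

  EdgeRegular : ℕ → ℕ → ℕ → Set
  EdgeRegular N k l =
    length vs ≡ N × Regular k ×
    (∀ v w → v ∈ vs → w ∈ vs → A v w ≡ true → common v w ≡ l)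

  NotComplete : Set
  NotComplete = Σ V λ v → Σ V λ w → v ∈ vs × w ∈ vs × ¬ (v ≡ w) × A v w ≡ false

  NotEmpty : Set
  NotEmpty = Σ V λ v → Σ V λ w → v ∈ vs × w ∈ vs × A v w ≡ true

  StronglyRegular : ℕ → ℕ → ℕ → ℕ → Set
  StronglyRegular N k l m =
    NotComplete × NotEmpty × EdgeRegular N k l ×
    (∀ v w → v ∈ vs → w ∈ vs → ¬ (v ≡ w) → A v w ≡ false → common v w ≡ m)

record SimpleGraph (n : ℕ) : Set where
  field
    adj    : Fin n → Fin n → Bool
    sym    : ∀ x y → adj x y ≡ adj y x
    irrefl : ∀ x → adj x x ≡ false

open SimpleGraph public

verts : (n : ℕ) → List (Fin n)
verts n = allFinL n

module _ {n : ℕ} (G : SimpleGraph n) where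
  open GraphNotions (verts n) (adj G) public
    renaming (Connected to GConnected; StronglyRegular to GStronglyRegular)

-- Anti-Gallai graph Δ(G): vertices are the edges {x,y} of G, encoded as
-- ordered pairs (x , y) with x < y; two are adjacent iff they are distinct
-- edges lying on a common triangle of G.

eqᵇ : ∀ {n} → Fin n → Fin n → Bool
eqᵇ x y = ⌊ x ≟ y ⌋

isEdge : ∀ {n} → SimpleGraph n → Fin n × Fin n → Bool
isEdge G (x , y) = (toℕ x <ᵇ toℕ y) ∧ adj G x y

allPairs : (n : ℕ) → List (Fin n × Fin n)
allPairs n = concatMap (λ x → map (λ y → (x , y)) (verts n)) (verts n)

ΔVerts : ∀ {n} → SimpleGraph n → List (Fin n × Fin n)
ΔVerts {n} G = filterᵇ (isEdge G) (allPairs n)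

sameEdgeᵇ : ∀ {n} → Fin n × Fin n → Fin n × Fin n → Bool
sameEdgeᵇ (a , b) (c , d) = eqᵇ a c ∧ eqᵇ b d

in3 : ∀ {n} → Fin n → Fin n → Fin n → Fin n → Bool
in3 a x y z = eqᵇ a x ∨ eqᵇ a y ∨ eqᵇ a z

onTriangle : ∀ {n} → SimpleGraph n → Fin n × Fin n → Fin n × Fin n → Bool
onTriangle {n} G (a , b) (c , d) =
  any (λ x → any (λ y → any (λ z →
        adj G x y ∧ adj G y z ∧ adj G x z ∧
        in3 a x y z ∧ in3 b x y z ∧ in3 c x y z ∧ in3 d x y z)
      (verts n)) (verts n)) (verts n)

Δadj : ∀ {n} → SimpleGraph n → Fin n × Fin n → Fin n × Fin n → Bool
Δadj G e f = isEdge G e ∧ isEdge G f ∧ not (sameEdgeᵇ e f) ∧ onTriangle G e f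

module Δ {n : ℕ} (G : SimpleGraph n) =
  GraphNotions (ΔVerts G) (Δadj G)

Consec : ∀ {m} → Fin m → Fin m → Set
Consec {m} i j = (suc (toℕ i) ≡ toℕ j) ⊎ (suc (toℕ i) ≡ m × toℕ j ≡ 0)

record Wheel {n : ℕ} (G : SimpleGraph n) (u : Fin n) : Set where
  field
    m      : ℕ
    m≥3    : 3 ≤ m
    v      : Fin m → Fin n
    inj    : ∀ i j → v i ≡ v j → i ≡ j
    ≢u     : ∀ i → ¬ (v i ≡ u)
    spoke  : ∀ i → adj G u (v i) ≡ true
    rim    : ∀ i j → Consec i j → adj G (v i) (v j) ≡ true

module _ {n : ℕ} {G : SimpleGraph n} {u : Fin n} where
  open Wheel

  WVert : Wheel G u → Fin n → Set
  WVert w x = x ≡ u ⊎ ∃ λ i → x ≡ v w i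

  WEdge : Wheel G u → Fin n → Fin n → Set
  WEdge w x y =
    (x ≡ u × ∃ λ i → y ≡ v w i) ⊎ (y ≡ u × ∃ λ i → x ≡ v w i) ⊎
    (∃ λ i → ∃ λ j → Consec i j ×
       ((x ≡ v w i × y ≡ v w j) ⊎ (x ≡ v w j × y ≡ v w i)))

_⇔'_ : Set → Set → Set
P ⇔' Q = (P → Q) × (Q → P)

SameSubgraph : ∀ {n} {G : SimpleGraph n} {u} → Wheel G u → Wheel G u → Set
SameSubgraph {n} w w' =
  (∀ (x : Fin n) → WVert w x ⇔' WVert w' x) ×
  (∀ (x y : Fin n) → WEdge w x y ⇔' WEdge w' x y)

UniqueWheel : ∀ {n} → SimpleGraph n → Fin n → Set
UniqueWheel G u = Σ (Wheel G u) λ w → ∀ (w' : Wheel G u) → SameSubgraph w w'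

-- Since λ = 2, the neighbourhood of every vertex u induces a 2-regular graph, so a
-- non-backtracking walk in it closes up into a cycle through any given neighbour of u:
-- every neighbour of u lies on some wheel centred at u, hence on the rim of the unique one.
-- An edge pq lies in exactly two triangles pqc and pqd, so its neighbours in Δ(G) are
-- pc, qc, pd and qd. Two Δ-adjacent edges pq and pr have the common Δ-neighbour qr, and
-- any other one would span a K₄ with p, q, r. But the other three vertices of a K₄ form the
-- unique wheel at each of its vertices, so a K₄ is closed under adjacency and, G being
-- connected, G would be complete.
-- Hence Δ(G) is edge-regular with degree 4 and λ = 1. Consecutive spokes of a wheel lie on
-- a triangle, so all edges at a vertex are connected in Δ(G), and a path in G carries this
-- along to any other edge.

module Submission where

open import Data.Bool using (Bool; true; false; _∧_; _∨_; not; if_then_else_)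
open import Data.Bool.Properties using (T-≡; ∧-conicalˡ; ∧-conicalʳ)
open import Data.Bool.ListAction using (any)
open import Data.Empty using (⊥; ⊥-elim)
open import Data.Fin using (Fin; zero; suc; toℕ; fromℕ<)
import Data.Fin.Properties as Finₚ
open import Data.List using (List; []; _∷_; length; map; concatMap; filterᵇ; cartesianProduct; _++_)
open import Data.List.Membership.Propositional using (_∈_; lose; find)
open import Data.List.Membership.Propositional.Properties
  using (∈-allFin; ∈-filter⁺; ∈-filter⁻; ∈-cartesianProduct⁺)
open import Data.List.Membership.Propositional.Properties.WithK using (unique∧set⇒bag)
open import Data.List.Relation.Binary.BagAndSetEquality using (∼bag⇒↭)
open import Data.List.Relation.Binary.Permutation.Propositional.Properties using (↭-length)
open import Data.List.Relation.Unary.All as All using ([]; _∷_)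
open import Data.List.Relation.Unary.AllPairs using (AllPairs; []; _∷_)
open import Data.List.Relation.Unary.Any using (here; there)
open import Data.List.Relation.Unary.Any.Properties using (any⁺; any⁻)
open import Data.List.Relation.Unary.Unique.Propositional using (Unique)
import Data.List.Relation.Unary.Unique.Propositional.Properties as Uniqueₚ
open import Data.Nat using (ℕ; zero; suc; _<_; _≤_; _<ᵇ_; z≤n; s≤s)
import Data.Nat.Properties as ℕₚ
open import Data.Product using (Σ; ∃; _×_; _,_; proj₁; proj₂)
open import Data.Sum using (_⊎_; inj₁; inj₂; [_,_]) renaming (map to ⊎-map)
open import Function using (_∘_; id; const; _⇔_; mk⇔; Equivalence)
open import Relation.Binary.Definitions using (DecidableEquality; tri<; tri≈; tri>)
open import Relation.Nullary using (¬_; yes; no)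
open import Relation.Nullary.Decidable using (T?; dec-true; dec-false)
open import Relation.Binary.PropositionalEquality as ≡
  using (_≡_; _≢_; refl; trans; cong; cong₂; subst; subst₂)
open import Defs

open Equivalence using (to; from)

∧≡true⇔ : ∀ {a b} → a ∧ b ≡ true ⇔ (a ≡ true × b ≡ true)
∧≡true⇔ {a} {b} =
  mk⇔ (λ h → ∧-conicalˡ a b h , ∧-conicalʳ a b h) (λ (ha , hb) → cong₂ _∧_ ha hb)

∨≡true⇔ : ∀ {a b} → a ∨ b ≡ true ⇔ (a ≡ true ⊎ b ≡ true)
∨≡true⇔ {true}  = mk⇔ (const (inj₁ refl)) (const refl)
∨≡true⇔ {false} = mk⇔ inj₂ [ (λ ()) , id ]

any≡true⇔ : ∀ {A : Set} (p : A → Bool) xs → any p xs ≡ true ⇔ (∃ λ x → x ∈ xs × p x ≡ true)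
any≡true⇔ p xs = mk⇔
  (λ h → let x , x∈ , px = find (any⁻ p xs (from T-≡ h)) in x , x∈ , to T-≡ px)
  (λ (x , x∈ , px) → to T-≡ (any⁺ p (lose x∈ (from T-≡ px))))

module _ {V : Set} (p : V → Bool) where

  cnt≡length∘filterᵇ : ∀ xs → cnt p xs ≡ length (filterᵇ p xs)
  cnt≡length∘filterᵇ []       = refl
  cnt≡length∘filterᵇ (x ∷ xs) with p x
  ... | true  = cong suc (cnt≡length∘filterᵇ xs)
  ... | false = cnt≡length∘filterᵇ xs

  ∈-filterᵇ⇔ : ∀ xs {z} → z ∈ filterᵇ p xs ⇔ (z ∈ xs × p z ≡ true)
  ∈-filterᵇ⇔ xs = mk⇔
    (λ z∈ → let z∈xs , pz = ∈-filter⁻ (T? ∘ p) z∈ in z∈xs , to T-≡ pz)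
    (λ (z∈xs , pz) → ∈-filter⁺ (T? ∘ p) z∈xs (from T-≡ pz))

  unique-filterᵇ : ∀ {xs} → Unique xs → Unique (filterᵇ p xs)
  unique-filterᵇ = Uniqueₚ.filter⁺ (T? ∘ p)

  cnt≡length : ∀ {xs ys} → Unique xs → Unique ys →
               (∀ {z} → z ∈ ys ⇔ (z ∈ xs × p z ≡ true)) → cnt p xs ≡ length ys
  cnt≡length {xs} {ys} !xs !ys ys⇔ = trans (cnt≡length∘filterᵇ xs)
    (↭-length (∼bag⇒↭ (unique∧set⇒bag (unique-filterᵇ !xs) !ys
      (mk⇔ (from ys⇔ ∘ to (∈-filterᵇ⇔ xs)) (from (∈-filterᵇ⇔ xs) ∘ to ys⇔)))))

record ExactlyTwo {V : Set} (P : V → Set) : Set where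
  field
    first second  : V
    first≢second  : first ≢ second
    holds-first   : P first
    holds-second  : P second
    only          : ∀ {z} → P z → z ≡ first ⊎ z ≡ second

  other-than : DecidableEquality V → (t : V) → ∃ λ z → P z × z ≢ t
  other-than _≟_ t with first ≟ t
  ... | yes refl    = second , holds-second , first≢second ∘ ≡.sym
  ... | no first≢t = first , holds-first , first≢t

  no-three-distinct : ∀ {a b c} → P a → P b → P c → a ≢ b → a ≢ c → b ≢ c → ⊥
  no-three-distinct pa pb pc a≢b a≢c b≢c with only pa | only pb | only pc
  ... | inj₁ refl | inj₁ refl | _         = a≢b refl
  ... | inj₁ refl | inj₂ refl | inj₁ refl = a≢c refl
  ... | inj₁ refl | inj₂ refl | inj₂ refl = b≢c refl
  ... | inj₂ refl | inj₁ refl | inj₁ refl = b≢c refl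
  ... | inj₂ refl | inj₁ refl | inj₂ refl = a≢c refl
  ... | inj₂ refl | inj₂ refl | _         = a≢b refl

ExactlyTwo-map : ∀ {V : Set} {P Q : V → Set} → (∀ {z} → P z ⇔ Q z) → ExactlyTwo P → ExactlyTwo Q
ExactlyTwo-map P⇔Q two = record
  { first = first ; second = second ; first≢second = first≢second
  ; holds-first = to P⇔Q holds-first ; holds-second = to P⇔Q holds-second
  ; only = only ∘ from P⇔Q }
  where open ExactlyTwo two

cnt≡2⇒ExactlyTwo : ∀ {V : Set} (p : V → Bool) {xs} → Unique xs → (∀ z → z ∈ xs) →
                   cnt p xs ≡ 2 → ExactlyTwo (λ z → p z ≡ true)
cnt≡2⇒ExactlyTwo p {xs} !xs complete cnt≡2
  with filterᵇ p xs | (λ z → ∈-filterᵇ⇔ p xs {z}) | unique-filterᵇ p !xs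
     | trans (≡.sym (cnt≡length∘filterᵇ p xs)) cnt≡2
... | c ∷ d ∷ [] | mem | (c≢d ∷ []) ∷ _ | _ = record
  { first = c ; second = d ; first≢second = c≢d
  ; holds-first = proj₂ (to (mem c) (here refl)) ; holds-second = proj₂ (to (mem d) (there (here refl)))
  ; only = λ {z} pz → both (from (mem z) (complete z , pz)) }
  where
  both : ∀ {z} → z ∈ c ∷ d ∷ [] → z ≡ c ⊎ z ≡ d
  both (here z≡c)          = inj₁ z≡c
  both (there (here z≡d))  = inj₂ z≡d
  both (there (there ()))
... | []                 | _ | _ | ()
... | _ ∷ []             | _ | _ | ()
... | _ ∷ _ ∷ _ ∷ _      | _ | _ | ()

module _ {A : Set} (f : ℕ → A) where

  InjectiveBelow : ℕ → Set
  InjectiveBelow j = ∀ {a b} → a < j → b < j → f a ≡ f b → a ≡ b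

  record FirstRepeat : Set where
    field
      period                 : ℕ
      injective-below-period : InjectiveBelow period
      start                  : ℕ
      start<period           : start < period
      repeats                : f start ≡ f period

  injective-below-or-FirstRepeat : DecidableEquality A → ∀ N → InjectiveBelow (suc N) ⊎ FirstRepeat
  injective-below-or-FirstRepeat _≟_ zero = inj₁ λ { (s≤s z≤n) (s≤s z≤n) _ → refl }
  injective-below-or-FirstRepeat _≟_ (suc N) with injective-below-or-FirstRepeat _≟_ N
  ... | inj₂ r = inj₂ r
  ... | inj₁ inj with Finₚ.any? {n = suc N} (λ k → f (toℕ k) ≟ f (suc N))
  ... | yes (k , fk≡) = inj₂ record
    { period = suc N ; injective-below-period = inj
    ; start = toℕ k ; start<period = Finₚ.toℕ<n k ; repeats = fk≡ }
  ... | no no-repeat = inj₁ inj′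
    where
    inj′ : InjectiveBelow (suc (suc N))
    inj′ a< b< fa≡fb with ℕₚ.m<1+n⇒m<n∨m≡n a< | ℕₚ.m<1+n⇒m<n∨m≡n b<
    ... | inj₁ a<N   | inj₁ b<N   = inj a<N b<N fa≡fb
    ... | inj₂ refl  | inj₂ refl  = refl
    ... | inj₁ a<N   | inj₂ refl  =
      ⊥-elim (no-repeat (fromℕ< a<N , trans (cong f (Finₚ.toℕ-fromℕ< a<N)) fa≡fb))
    ... | inj₂ refl  | inj₁ b<N   =
      ⊥-elim (no-repeat (fromℕ< b<N , trans (cong f (Finₚ.toℕ-fromℕ< b<N)) (≡.sym fa≡fb)))

first-repeat : ∀ {n} (f : ℕ → Fin n) → FirstRepeat f
first-repeat {n} f with injective-below-or-FirstRepeat f Finₚ._≟_ n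
... | inj₂ r   = r
... | inj₁ inj with Finₚ.pigeonhole (ℕₚ.n<1+n n) (f ∘ toℕ)
... | i , j , i<j , fi≡fj = ⊥-elim (ℕₚ.<⇒≢ i<j (inj (Finₚ.toℕ<n i) (Finₚ.toℕ<n j) fi≡fj))

module ReachProperties {V : Set} (vs : List V) (A : V → V → Bool) where
  open GraphNotions vs A public using () renaming (Reach to _⇝_; here to done; step to hop)

  Reach-trans : ∀ {x y z} → x ⇝ y → y ⇝ z → x ⇝ z
  Reach-trans done         r′ = r′
  Reach-trans (hop v∈ a r) r′ = hop v∈ a (Reach-trans r r′)

  Reach-snoc : ∀ {x y z} → x ⇝ y → z ∈ vs → A y z ≡ true → x ⇝ z
  Reach-snoc done          z∈ a = hop z∈ a done
  Reach-snoc (hop v∈ a r) z∈ b = hop v∈ a (Reach-snoc r z∈ b)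

  Reach-sym : (∀ {x y} → A x y ≡ true → A y x ≡ true) →
              ∀ {x y} → x ∈ vs → x ⇝ y → y ⇝ x
  Reach-sym A-sym x∈ done          = done
  Reach-sym A-sym x∈ (hop v∈ a r) = Reach-snoc (Reach-sym A-sym v∈ r) x∈ (A-sym a)

  Reach-closed : (Q : V → Set) → (∀ {x y} → Q x → A x y ≡ true → Q y) →
                 ∀ {x y} → x ⇝ y → Q x → Q y
  Reach-closed Q closed done          qx = qx
  Reach-closed Q closed (hop _ a r)  qx = Reach-closed Q closed r (closed qx a)

module Basics {n : ℕ} (G : SimpleGraph n) where

  infix 4 _∼_
  _∼_ : Fin n → Fin n → Set
  x ∼ y = adj G x y ≡ true

  ∼-sym : ∀ {x y} → x ∼ y → y ∼ x
  ∼-sym {x} {y} x∼y = trans (sym G y x) x∼y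

  ∼-irrefl : ∀ {x} → ¬ x ∼ x
  ∼-irrefl {x} x∼x with () ← trans (≡.sym x∼x) (irrefl G x)

  ≡false⇒≁ : ∀ {x y} → adj G x y ≡ false → ¬ x ∼ y
  ≡false⇒≁ x≁y x∼y with () ← trans (≡.sym x∼y) x≁y

  ∼⇒≢ : ∀ {x y} → x ∼ y → x ≢ y
  ∼⇒≢ x∼y refl = ∼-irrefl x∼y

  K4-free : Set
  K4-free = ∀ {a b c d} → ¬ AllPairs _∼_ (a ∷ b ∷ c ∷ d ∷ [])

  Triangle : Fin n → Fin n → Fin n → Set
  Triangle x y z = x ∼ y × y ∼ z × x ∼ z

  ∈-verts : ∀ x → x ∈ verts n
  ∈-verts = ∈-allFin

  unique-verts : Unique (verts n)
  unique-verts = Uniqueₚ.allFin⁺ n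

  two-neighbours-in : ∀ (P : Fin n → Bool) {x} → cnt (λ z → P z ∧ adj G x z) (verts n) ≡ 2 →
                      ExactlyTwo (λ z → P z ≡ true × x ∼ z)
  two-neighbours-in P cnt≡2 =
    ExactlyTwo-map ∧≡true⇔ (cnt≡2⇒ExactlyTwo _ unique-verts ∈-verts cnt≡2)

  AllPairs⇒adjacent : ∀ {xs x y} → AllPairs _∼_ xs → x ∈ xs → y ∈ xs → x ≢ y → x ∼ y
  AllPairs⇒adjacent (_ ∷ _)    (here refl) (here refl) x≢y = ⊥-elim (x≢y refl)
  AllPairs⇒adjacent (x∼ ∷ _)   (here refl) (there y∈)  _   = All.lookup x∼ y∈
  AllPairs⇒adjacent (y∼ ∷ _)   (there x∈)  (here refl) _   = ∼-sym (All.lookup y∼ x∈)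
  AllPairs⇒adjacent (_ ∷ all)  (there x∈)  (there y∈)  x≢y = AllPairs⇒adjacent all x∈ y∈ x≢y

-- Cycles in a 2-regular induced subgraph

module Cycles {n : ℕ} (G : SimpleGraph n) (P : Fin n → Bool) where
  open Basics G

  TwoRegular : Set
  TwoRegular = ∀ {x} → P x ≡ true → cnt (λ z → P z ∧ adj G x z) (verts n) ≡ 2

  record Cycle : Set where
    field
      m      : ℕ
      m≥3    : 3 ≤ m
      v      : Fin m → Fin n
      inj    : ∀ i j → v i ≡ v j → i ≡ j
      inside : ∀ i → P (v i) ≡ true
      rim    : ∀ i j → Consec i j → v i ∼ v j

  -- By 2-regularity the first vertex repeated by a non-backtracking walk is its start.
  module NonBacktrackingWalk (two-regular : TwoRegular) {y} (Py : P y ≡ true) where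

    P-neighbours : ∀ {x} → P x ≡ true → ExactlyTwo (λ z → P z ≡ true × x ∼ z)
    P-neighbours Px = two-neighbours-in P (two-regular Px)

    record Arc : Set where
      constructor arc
      field
        tail head   : Fin n
        tail-inside : P tail ≡ true
        head-inside : P head ≡ true
        tail∼head   : tail ∼ head

    advance : Arc → Arc
    advance (arc t h _ Ph _) =
      let c , (Pc , h∼c) , _ = ExactlyTwo.other-than (P-neighbours Ph) Finₚ._≟_ t
      in arc h c Ph Pc h∼c

    advance-turns : ∀ a → Arc.head (advance a) ≢ Arc.tail a
    advance-turns (arc t h _ Ph _) = proj₂ (proj₂ (ExactlyTwo.other-than (P-neighbours Ph) Finₚ._≟_ t))

    arcs : ℕ → Arc
    arcs zero    = arc y first Py (proj₁ holds-first) (proj₂ holds-first)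
      where open ExactlyTwo (P-neighbours Py)
    arcs (suc i) = advance (arcs i)

    walk : ℕ → Fin n
    walk = Arc.tail ∘ arcs

    walk-inside : ∀ i → P (walk i) ≡ true
    walk-inside = Arc.tail-inside ∘ arcs

    walk-step : ∀ i → walk i ∼ walk (suc i)
    walk-step = Arc.tail∼head ∘ arcs

    walk-no-backtrack : ∀ i → walk (suc (suc i)) ≢ walk i
    walk-no-backtrack i = advance-turns (arcs i)

    -- Otherwise walk (1 + i) has the three P-neighbours walk i, walk (2 + i) and walk j.
    no-inner-repeat : ∀ {i j} → InjectiveBelow walk (suc j) → suc (suc i) < j →
                      walk (suc i) ≢ walk (suc j)
    no-inner-repeat {i} {j} inj 2+i<j w≡w =
      ExactlyTwo.no-three-distinct (P-neighbours (walk-inside (suc i)))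
        (walk-inside i , ∼-sym (walk-step i))
        (walk-inside (suc (suc i)) , walk-step (suc i))
        (walk-inside j , subst (_∼ walk j) (≡.sym w≡w) (∼-sym (walk-step j)))
        (distinct i<2+i 2+i<1+j) (distinct (ℕₚ.<-trans i<2+i 2+i<j) j<1+j) (distinct 2+i<j j<1+j)
      where
      j<1+j = ℕₚ.n<1+n j
      2+i<1+j = ℕₚ.<-trans 2+i<j j<1+j
      i<2+i = ℕₚ.<-trans (ℕₚ.n<1+n i) (ℕₚ.n<1+n (suc i))
      distinct : ∀ {a b} → a < b → b < suc j → walk a ≢ walk b
      distinct a<b b<1+j wa≡wb = ℕₚ.<⇒≢ a<b (inj (ℕₚ.<-trans a<b b<1+j) b<1+j wa≡wb)

    repeat-is-return : ∀ {i J} → InjectiveBelow walk J → i < J → walk i ≡ walk J → i ≡ 0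
    repeat-is-return {zero}  _   _   _   = refl
    repeat-is-return {suc i} inj i<J w≡w with ℕₚ.m≤n⇒m<n∨m≡n i<J
    ... | inj₂ refl = ⊥-elim (∼-irrefl (subst (walk (suc i) ∼_) (≡.sym w≡w) (walk-step (suc i))))
    ... | inj₁ 1+i<J with ℕₚ.m≤n⇒m<n∨m≡n 1+i<J
    ... | inj₂ refl          = ⊥-elim (walk-no-backtrack (suc i) (≡.sym w≡w))
    ... | inj₁ (s≤s 2+i<j)  = ⊥-elim (no-inner-repeat inj 2+i<j w≡w)

    return-period≥3 : ∀ {J} → 0 < J → walk 0 ≡ walk J → 3 ≤ J
    return-period≥3 {1} _ w≡w = ⊥-elim (∼-irrefl (subst (walk 0 ∼_) (≡.sym w≡w) (walk-step 0)))
    return-period≥3 {2} _ w≡w = ⊥-elim (walk-no-backtrack 0 (≡.sym w≡w))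
    return-period≥3 {suc (suc (suc _))} _ _ = s≤s (s≤s (s≤s z≤n))

    open FirstRepeat (first-repeat walk)

    0<period : 0 < period
    0<period = ℕₚ.<-≤-trans (s≤s z≤n) start<period

    returns : walk 0 ≡ walk period
    returns = subst (λ s → walk s ≡ walk period)
                    (repeat-is-return injective-below-period start<period repeats) repeats

    cycle : Cycle
    cycle = record
      { m = period
      ; m≥3 = return-period≥3 0<period returns
      ; v = walk ∘ toℕ
      ; inj = λ i j e → Finₚ.toℕ-injective
          (injective-below-period (Finₚ.toℕ<n i) (Finₚ.toℕ<n j) e)
      ; inside = walk-inside ∘ toℕ
      ; rim = rim }
      where
      rim : ∀ i j → Consec i j → walk (toℕ i) ∼ walk (toℕ j)
      rim i j (inj₁ 1+i≡j)          = subst (λ k → walk (toℕ i) ∼ walk k) 1+i≡j (walk-step (toℕ i))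
      rim i j (inj₂ (1+i≡m , j≡0)) =
        subst (walk (toℕ i) ∼_) (trans (cong walk 1+i≡m) (trans (≡.sym returns) (cong walk (≡.sym j≡0))))
              (walk-step (toℕ i))

    y-on-cycle : ∃ λ i → y ≡ Cycle.v cycle i
    y-on-cycle = fromℕ< 0<period , cong walk (≡.sym (Finₚ.toℕ-fromℕ< 0<period))

  cycle-through : TwoRegular → ∀ {y} → P y ≡ true → Σ Cycle λ C → ∃ λ i → y ≡ Cycle.v C i
  cycle-through two-regular Py = cycle , y-on-cycle
    where open NonBacktrackingWalk two-regular Py

-- Wheels

Consec-irrefl : ∀ {m} {i : Fin m} → Consec i i → m ≡ 1
Consec-irrefl (inj₁ 1+i≡i)          = ⊥-elim (ℕₚ.1+n≢n 1+i≡i)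
Consec-irrefl (inj₂ (1+i≡m , i≡0)) = trans (≡.sym 1+i≡m) (cong suc i≡0)

wheel-of-cycle : ∀ {n} {G : SimpleGraph n} {u} → Cycles.Cycle G (adj G u) → Wheel G u
wheel-of-cycle {G = G} C = record
  { m = m ; m≥3 = m≥3 ; v = v ; inj = inj
  ; ≢u = λ i vi≡u → ∼⇒≢ (inside i) (≡.sym vi≡u) ; spoke = inside ; rim = rim }
  where open Cycles.Cycle C
        open Basics G

module Wheels {n : ℕ} (G : SimpleGraph n)
  (common≡2 : ∀ {x y} → adj G x y ≡ true → common G x y ≡ 2)
  (unique-wheel : ∀ u → UniqueWheel G u) where
  open Basics G

  wheel-through : ∀ {u y} → u ∼ y → Σ (Wheel G u) λ W → ∃ λ i → y ≡ Wheel.v W i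
  wheel-through {u} u∼y =
    let C , y-on-C = Cycles.cycle-through G (adj G u) common≡2 u∼y in wheel-of-cycle C , y-on-C

  neighbour-on-rim : ∀ {u y} (W : Wheel G u) → u ∼ y → ∃ λ i → y ≡ Wheel.v W i
  neighbour-on-rim {u} {y} W u∼y with unique-wheel u | wheel-through u∼y
  ... | U , same | W′ , y-on-W′
    with proj₁ (proj₁ (same W) y) (proj₂ (proj₁ (same W′) y) (inj₂ y-on-W′))
  ... | inj₁ y≡u  = ⊥-elim (∼⇒≢ u∼y (≡.sym y≡u))
  ... | inj₂ y-on-W = y-on-W

  triangle-wheel : ∀ {x p q r} → x ∼ p → x ∼ q → x ∼ r → Triangle p q r → Wheel G x
  triangle-wheel {x} {p} {q} {r} x∼p x∼q x∼r (p∼q , q∼r , p∼r) = record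
    { m = 3 ; m≥3 = ℕₚ.≤-refl ; v = v ; inj = inj
    ; ≢u = λ i vi≡x → ∼⇒≢ (spoke i) (≡.sym vi≡x) ; spoke = spoke
    ; rim = λ i j c → adjacent λ { refl → 3≢1 (Consec-irrefl c) } }
    where
    3≢1 : 3 ≢ 1
    3≢1 ()
    v : Fin 3 → Fin n
    v zero             = p
    v (suc zero)       = q
    v (suc (suc zero)) = r
    spoke : ∀ i → x ∼ v i
    spoke zero             = x∼p
    spoke (suc zero)       = x∼q
    spoke (suc (suc zero)) = x∼r
    adjacent : ∀ {i j} → i ≢ j → v i ∼ v j
    adjacent {zero}             {zero}             i≢j = ⊥-elim (i≢j refl)
    adjacent {zero}             {suc zero}         _   = p∼q
    adjacent {zero}             {suc (suc zero)}   _   = p∼r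
    adjacent {suc zero}         {zero}             _   = ∼-sym p∼q
    adjacent {suc zero}         {suc zero}         i≢j = ⊥-elim (i≢j refl)
    adjacent {suc zero}         {suc (suc zero)}   _   = q∼r
    adjacent {suc (suc zero)}   {zero}             _   = ∼-sym p∼r
    adjacent {suc (suc zero)}   {suc zero}         _   = ∼-sym q∼r
    adjacent {suc (suc zero)}   {suc (suc zero)}   i≢j = ⊥-elim (i≢j refl)
    inj : ∀ i j → v i ≡ v j → i ≡ j
    inj i j vi≡vj with i Finₚ.≟ j
    ... | yes i≡j = i≡j
    ... | no  i≢j = ⊥-elim (∼⇒≢ (adjacent i≢j) vi≡vj)

  triangle-apex-neighbours : ∀ {x p q r y} → x ∼ p → x ∼ q → x ∼ r → Triangle p q r →
                             x ∼ y → y ≡ p ⊎ y ≡ q ⊎ y ≡ r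
  triangle-apex-neighbours x∼p x∼q x∼r pqr x∼y
    with neighbour-on-rim (triangle-wheel x∼p x∼q x∼r pqr) x∼y
  ... | zero , y≡p           = inj₁ y≡p
  ... | suc zero , y≡q       = inj₂ (inj₁ y≡q)
  ... | suc (suc zero) , y≡r = inj₂ (inj₂ y≡r)

<ᵇ≡true : ∀ {m n} → m < n → (m <ᵇ n) ≡ true
<ᵇ≡true {m} {n} = dec-true (T? (m <ᵇ n)) ∘ ℕₚ.<⇒<ᵇ

<ᵇ≡false : ∀ {m n} → ¬ m < n → (m <ᵇ n) ≡ false
<ᵇ≡false {m} {n} m≮n = dec-false (T? (m <ᵇ n)) (m≮n ∘ ℕₚ.<ᵇ⇒< m n)

edge : ∀ {n} → Fin n → Fin n → Fin n × Fin n
edge x y = if toℕ x <ᵇ toℕ y then (x , y) else (y , x)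

module _ {n : ℕ} where

  edge-ordered : ∀ {x y : Fin n} → toℕ x < toℕ y → edge x y ≡ (x , y) × edge y x ≡ (x , y)
  edge-ordered x<y rewrite <ᵇ≡true x<y | <ᵇ≡false (ℕₚ.<⇒≯ x<y) = refl , refl

  edge-comm : ∀ {x y : Fin n} → x ≢ y → edge x y ≡ edge y x
  edge-comm {x} {y} x≢y with ℕₚ.<-cmp (toℕ x) (toℕ y)
  ... | tri< x<y _ _ = let xy , yx = edge-ordered x<y in trans xy (≡.sym yx)
  ... | tri≈ _ x≡y _ = ⊥-elim (x≢y (Finₚ.toℕ-injective x≡y))
  ... | tri> _ _ y<x = let yx , xy = edge-ordered y<x in trans xy (≡.sym yx)

  edge-cases : ∀ (x y : Fin n) → edge x y ≡ (x , y) ⊎ edge x y ≡ (y , x)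
  edge-cases x y with toℕ x <ᵇ toℕ y
  ... | true  = inj₁ refl
  ... | false = inj₂ refl

  edge-injective : ∀ {x y z w : Fin n} → edge x y ≡ edge z w → (x ≡ z × y ≡ w) ⊎ (x ≡ w × y ≡ z)
  edge-injective {x} {y} {z} {w} e with edge-cases x y | edge-cases z w
  ... | inj₁ xy | inj₁ zw with refl ← trans (≡.sym xy) (trans e zw) = inj₁ (refl , refl)
  ... | inj₁ xy | inj₂ wz with refl ← trans (≡.sym xy) (trans e wz) = inj₂ (refl , refl)
  ... | inj₂ yx | inj₁ zw with refl ← trans (≡.sym yx) (trans e zw) = inj₂ (refl , refl)
  ... | inj₂ yx | inj₂ wz with refl ← trans (≡.sym yx) (trans e wz) = inj₁ (refl , refl)

  edge-≢ : ∀ {x y z w : Fin n} → ¬ (x ≡ z × y ≡ w) → ¬ (x ≡ w × y ≡ z) → edge x y ≢ edge z w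
  edge-≢ ¬same ¬swapped = [ ¬same , ¬swapped ] ∘ edge-injective

  edge-endpoints⁻ : ∀ (Q : Fin n → Set) {x y} → Q (proj₁ (edge x y)) → Q (proj₂ (edge x y)) → Q x × Q y
  edge-endpoints⁻ Q {x} {y} with toℕ x <ᵇ toℕ y
  ... | true  = _,_
  ... | false = λ qy qx → qx , qy

  edge-endpoints⁺ : ∀ (Q : Fin n → Set) {x y} → Q x → Q y → Q (proj₁ (edge x y)) × Q (proj₂ (edge x y))
  edge-endpoints⁺ Q {x} {y} with toℕ x <ᵇ toℕ y
  ... | true  = _,_
  ... | false = λ qx qy → qy , qx

allPairs≡cartesianProduct : ∀ n → allPairs n ≡ cartesianProduct (verts n) (verts n)
allPairs≡cartesianProduct n = go (verts n)
  where
  go : ∀ xs → concatMap (λ x → map (x ,_) (verts n)) xs ≡ cartesianProduct xs (verts n)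
  go []       = refl
  go (x ∷ xs) = cong (map (x ,_) (verts n) ++_) (go xs)

-- The anti-Gallai graph

eqᵇ≡true⇔ : ∀ {n} (a b : Fin n) → eqᵇ a b ≡ true ⇔ a ≡ b
eqᵇ≡true⇔ a b with a Finₚ.≟ b
... | yes a≡b = mk⇔ (const a≡b) (const refl)
... | no  a≢b = mk⇔ (λ ()) (⊥-elim ∘ a≢b)

not≡true⇔ : ∀ {b} → not b ≡ true ⇔ (¬ b ≡ true)
not≡true⇔ {true}  = mk⇔ (λ ()) (λ b≢true → ⊥-elim (b≢true refl))
not≡true⇔ {false} = mk⇔ (λ _ ()) (const refl)

sameEdgeᵇ≡true⇔ : ∀ {n} {e f : Fin n × Fin n} → sameEdgeᵇ e f ≡ true ⇔ e ≡ f
sameEdgeᵇ≡true⇔ {e = a , b} {c , d} = mk⇔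
  (λ h → let a≡c , b≡d = to ∧≡true⇔ h in cong₂ _,_ (to (eqᵇ≡true⇔ a c) a≡c) (to (eqᵇ≡true⇔ b d) b≡d))
  (λ { refl → from ∧≡true⇔ (from (eqᵇ≡true⇔ a c) refl , from (eqᵇ≡true⇔ b d) refl) })

OneOf : ∀ {n} → Fin n → Fin n → Fin n → Fin n → Set
OneOf a x y z = a ≡ x ⊎ a ≡ y ⊎ a ≡ z

in3≡true⇔ : ∀ {n} {a x y z : Fin n} → in3 a x y z ≡ true ⇔ OneOf a x y z
in3≡true⇔ {a = a} {x} {y} {z} = mk⇔
  (⊎-map (to (≡x)) (⊎-map (to (≡y)) (to (≡z)) ∘ to ∨≡true⇔) ∘ to ∨≡true⇔)
  (from ∨≡true⇔ ∘ ⊎-map (from (≡x)) (from ∨≡true⇔ ∘ ⊎-map (from (≡y)) (from (≡z))))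
  where ≡x = eqᵇ≡true⇔ a x ; ≡y = eqᵇ≡true⇔ a y ; ≡z = eqᵇ≡true⇔ a z

module AntiGallai {n : ℕ} (G : SimpleGraph n) where
  open Basics G

  isEdge⇔ : ∀ {x y} → isEdge G (x , y) ≡ true ⇔ (toℕ x < toℕ y × x ∼ y)
  isEdge⇔ {x} {y} = mk⇔
    (λ h → let x<y , x∼y = to ∧≡true⇔ h in ℕₚ.<ᵇ⇒< (toℕ x) (toℕ y) (from T-≡ x<y) , x∼y)
    (λ (x<y , x∼y) → cong₂ _∧_ (<ᵇ≡true x<y) x∼y)

  isEdge-edge : ∀ {x y} → x ∼ y → isEdge G (edge x y) ≡ true
  isEdge-edge {x} {y} x∼y with ℕₚ.<-cmp (toℕ x) (toℕ y)
  ... | tri< x<y _ _ rewrite proj₁ (edge-ordered x<y) = from isEdge⇔ (x<y , x∼y)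
  ... | tri≈ _ x≡y _ = ⊥-elim (∼⇒≢ x∼y (Finₚ.toℕ-injective x≡y))
  ... | tri> _ _ y<x rewrite proj₂ (edge-ordered y<x) = from isEdge⇔ (y<x , ∼-sym x∼y)

  isEdge⇒edge : ∀ {x y} → isEdge G (x , y) ≡ true → x ∼ y × (x , y) ≡ edge x y
  isEdge⇒edge h = let x<y , x∼y = to isEdge⇔ h in x∼y , ≡.sym (proj₁ (edge-ordered x<y))

  ∈ΔVerts⇔ : ∀ {e} → e ∈ ΔVerts G ⇔ isEdge G e ≡ true
  ∈ΔVerts⇔ {x , y} = mk⇔ (proj₂ ∘ to (∈-filterᵇ⇔ (isEdge G) (allPairs n)))
    (λ h → from (∈-filterᵇ⇔ (isEdge G) (allPairs n)) (∈-allPairs , h))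
    where
    ∈-allPairs : (x , y) ∈ allPairs n
    ∈-allPairs = subst ((x , y) ∈_) (≡.sym (allPairs≡cartesianProduct n))
                       (∈-cartesianProduct⁺ (∈-verts x) (∈-verts y))

  unique-ΔVerts : Unique (ΔVerts G)
  unique-ΔVerts = unique-filterᵇ (isEdge G)
    (subst Unique (≡.sym (allPairs≡cartesianProduct n))
           (Uniqueₚ.cartesianProduct⁺ unique-verts unique-verts))

  edge∈ΔVerts : ∀ {x y} → x ∼ y → edge x y ∈ ΔVerts G
  edge∈ΔVerts = from ∈ΔVerts⇔ ∘ isEdge-edge

  ΔVerts-view : ∀ {e} → e ∈ ΔVerts G → ∃ λ x → ∃ λ y → x ∼ y × e ≡ edge x y
  ΔVerts-view {x , y} e∈ = x , y , isEdge⇒edge (to ∈ΔVerts⇔ e∈)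

  Within : Fin n × Fin n → Fin n → Fin n → Fin n → Set
  Within (a , b) x y z = OneOf a x y z × OneOf b x y z

  OnCommonTriangle : Fin n × Fin n → Fin n × Fin n → Set
  OnCommonTriangle e f = ∃ λ x → ∃ λ y → ∃ λ z → Triangle x y z × Within e x y z × Within f x y z

  onTriangle⇔ : ∀ e f → onTriangle G e f ≡ true ⇔ OnCommonTriangle e f
  onTriangle⇔ (a , b) (c , d) = mk⇔ decode encode
    where
    body : Fin n → Fin n → Fin n → Bool
    body x y z = adj G x y ∧ adj G y z ∧ adj G x z ∧
                 in3 a x y z ∧ in3 b x y z ∧ in3 c x y z ∧ in3 d x y z
    decode : onTriangle G (a , b) (c , d) ≡ true → OnCommonTriangle (a , b) (c , d)
    decode h =
      let x , _ , hx = to (any≡true⇔ (λ x → any (λ y → any (body x y) (verts n)) (verts n)) (verts n)) h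
          y , _ , hy = to (any≡true⇔ (λ y → any (body x y) (verts n)) (verts n)) hx
          z , _ , hz = to (any≡true⇔ (body x y) (verts n)) hy
          x∼y , h₁   = to ∧≡true⇔ hz
          y∼z , h₂   = to ∧≡true⇔ h₁
          x∼z , h₃   = to ∧≡true⇔ h₂
          a∈ , h₄    = to ∧≡true⇔ h₃
          b∈ , h₅    = to ∧≡true⇔ h₄
          c∈ , d∈    = to ∧≡true⇔ h₅
      in x , y , z , (x∼y , y∼z , x∼z) , (to in3≡true⇔ a∈ , to in3≡true⇔ b∈)
                                        , (to in3≡true⇔ c∈ , to in3≡true⇔ d∈)
    encode : OnCommonTriangle (a , b) (c , d) → onTriangle G (a , b) (c , d) ≡ true
    encode (x , y , z , (x∼y , y∼z , x∼z) , (a∈ , b∈) , (c∈ , d∈)) =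
      from (any≡true⇔ _ (verts n)) (x , ∈-verts x , from (any≡true⇔ _ (verts n)) (y , ∈-verts y ,
        from (any≡true⇔ (body x y) (verts n)) (z , ∈-verts z ,
        cong₂ _∧_ x∼y (cong₂ _∧_ y∼z (cong₂ _∧_ x∼z (cong₂ _∧_ (from in3≡true⇔ a∈)
          (cong₂ _∧_ (from in3≡true⇔ b∈) (cong₂ _∧_ (from in3≡true⇔ c∈) (from in3≡true⇔ d∈)))))))))

  Δadj⇔ : ∀ e f → Δadj G e f ≡ true ⇔
          (isEdge G e ≡ true × isEdge G f ≡ true × e ≢ f × OnCommonTriangle e f)
  Δadj⇔ e f = mk⇔
    (λ h → let ie , h₁ = to ∧≡true⇔ h ; if′ , h₂ = to ∧≡true⇔ h₁ ; ne , tri = to ∧≡true⇔ h₂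
           in ie , if′ , to not≡true⇔ ne ∘ from sameEdgeᵇ≡true⇔ , to (onTriangle⇔ e f) tri)
    (λ (ie , if′ , e≢f , tri) →
       cong₂ _∧_ ie (cong₂ _∧_ if′ (cong₂ _∧_ (from not≡true⇔ (e≢f ∘ to sameEdgeᵇ≡true⇔))
                                             (from (onTriangle⇔ e f) tri))))

  Δadj-sym : ∀ {e f} → Δadj G e f ≡ true → Δadj G f e ≡ true
  Δadj-sym {e} {f} h =
    let ie , if′ , e≢f , x , y , z , xyz , e-in , f-in = to (Δadj⇔ e f) h
    in from (Δadj⇔ f e) (if′ , ie , e≢f ∘ ≡.sym , x , y , z , xyz , f-in , e-in)

  third-vertex : ∀ {x y z a b} → Triangle x y z → OneOf a x y z → OneOf b x y z → a ≢ b →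
                 ∃ λ s → a ∼ s × b ∼ s × (∀ {w} → OneOf w x y z → OneOf w a b s)
  third-vertex _ (inj₁ refl) (inj₁ refl) a≢b = ⊥-elim (a≢b refl)
  third-vertex _ (inj₂ (inj₁ refl)) (inj₂ (inj₁ refl)) a≢b = ⊥-elim (a≢b refl)
  third-vertex _ (inj₂ (inj₂ refl)) (inj₂ (inj₂ refl)) a≢b = ⊥-elim (a≢b refl)
  third-vertex (x∼y , y∼z , x∼z) (inj₁ refl) (inj₂ (inj₁ refl)) _ = _ , x∼z , y∼z , id
  third-vertex (x∼y , y∼z , x∼z) (inj₁ refl) (inj₂ (inj₂ refl)) _ = _ , x∼y , ∼-sym y∼z ,
    λ { (inj₁ w≡x)        → inj₁ w≡x
      ; (inj₂ (inj₁ w≡y)) → inj₂ (inj₂ w≡y)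
      ; (inj₂ (inj₂ w≡z)) → inj₂ (inj₁ w≡z) }
  third-vertex (x∼y , y∼z , x∼z) (inj₂ (inj₁ refl)) (inj₁ refl) _ = _ , y∼z , x∼z ,
    λ { (inj₁ w≡x)        → inj₂ (inj₁ w≡x)
      ; (inj₂ (inj₁ w≡y)) → inj₁ w≡y
      ; (inj₂ (inj₂ w≡z)) → inj₂ (inj₂ w≡z) }
  third-vertex (x∼y , y∼z , x∼z) (inj₂ (inj₁ refl)) (inj₂ (inj₂ refl)) _ = _ , ∼-sym x∼y , ∼-sym x∼z ,
    λ { (inj₁ w≡x)        → inj₂ (inj₂ w≡x)
      ; (inj₂ (inj₁ w≡y)) → inj₁ w≡y
      ; (inj₂ (inj₂ w≡z)) → inj₂ (inj₁ w≡z) }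
  third-vertex (x∼y , y∼z , x∼z) (inj₂ (inj₂ refl)) (inj₁ refl) _ = _ , ∼-sym y∼z , x∼y ,
    λ { (inj₁ w≡x)        → inj₂ (inj₁ w≡x)
      ; (inj₂ (inj₁ w≡y)) → inj₂ (inj₂ w≡y)
      ; (inj₂ (inj₂ w≡z)) → inj₁ w≡z }
  third-vertex (x∼y , y∼z , x∼z) (inj₂ (inj₂ refl)) (inj₂ (inj₁ refl)) _ = _ , ∼-sym x∼z , ∼-sym x∼y ,
    λ { (inj₁ w≡x)        → inj₂ (inj₂ w≡x)
      ; (inj₂ (inj₁ w≡y)) → inj₂ (inj₁ w≡y)
      ; (inj₂ (inj₂ w≡z)) → inj₁ w≡z }

  other-edge-of-triangle : ∀ {c d p q s} → c ∼ d → OneOf c p q s → OneOf d p q s →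
                           edge c d ≢ edge p q → edge c d ≡ edge p s ⊎ edge c d ≡ edge q s
  other-edge-of-triangle c∼c (inj₁ refl)        (inj₁ refl)        _ = ⊥-elim (∼-irrefl c∼c)
  other-edge-of-triangle c∼c (inj₂ (inj₁ refl)) (inj₂ (inj₁ refl)) _ = ⊥-elim (∼-irrefl c∼c)
  other-edge-of-triangle c∼c (inj₂ (inj₂ refl)) (inj₂ (inj₂ refl)) _ = ⊥-elim (∼-irrefl c∼c)
  other-edge-of-triangle _   (inj₁ refl)        (inj₂ (inj₁ refl)) ≢pq = ⊥-elim (≢pq refl)
  other-edge-of-triangle q∼p (inj₂ (inj₁ refl)) (inj₁ refl)        ≢pq = ⊥-elim (≢pq (edge-comm (∼⇒≢ q∼p)))
  other-edge-of-triangle _   (inj₁ refl)        (inj₂ (inj₂ refl)) _ = inj₁ refl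
  other-edge-of-triangle _   (inj₂ (inj₁ refl)) (inj₂ (inj₂ refl)) _ = inj₂ refl
  other-edge-of-triangle s∼p (inj₂ (inj₂ refl)) (inj₁ refl)        _ = inj₁ (edge-comm (∼⇒≢ s∼p))
  other-edge-of-triangle s∼q (inj₂ (inj₂ refl)) (inj₂ (inj₁ refl)) _ = inj₂ (edge-comm (∼⇒≢ s∼q))

  Δ-neighbour : ∀ {p q g} → p ∼ q → Δadj G (edge p q) g ≡ true →
                ∃ λ s → p ∼ s × q ∼ s × (g ≡ edge p s ⊎ g ≡ edge q s)
  Δ-neighbour {p} {q} {c , d} p∼q h =
    let _ , isEdge-g , pq≢g , x , y , z , xyz , (pq₁ , pq₂) , (c∈ , d∈) = to (Δadj⇔ (edge p q) (c , d)) h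
        p∈ , q∈ = edge-endpoints⁻ (λ v → OneOf v x y z) {p} {q} pq₁ pq₂
        s , p∼s , q∼s , only = third-vertex xyz p∈ q∈ (∼⇒≢ p∼q)
        c∼d , g≡cd = isEdge⇒edge isEdge-g
    in s , p∼s , q∼s ,
       subst (λ g → g ≡ edge p s ⊎ g ≡ edge q s) (≡.sym g≡cd)
             (other-edge-of-triangle c∼d (only c∈) (only d∈) (λ cd≡pq → pq≢g (≡.sym (trans g≡cd cd≡pq))))

  Δadj-via : ∀ {p q s} → p ∼ q → p ∼ s → q ∼ s →
             Δadj G (edge p q) (edge p s) ≡ true × Δadj G (edge p q) (edge q s) ≡ true
  Δadj-via {p} {q} {s} p∼q p∼s q∼s =
    from (Δadj⇔ (edge p q) (edge p s)) (isEdge-edge p∼q , isEdge-edge p∼s ,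
                      edge-≢ (∼⇒≢ q∼s ∘ proj₂) (∼⇒≢ p∼s ∘ proj₁) ,
                      p , q , s , pqs , pq-in , edge-endpoints⁺ (λ v → OneOf v p q s) {p} {s} p∈ s∈) ,
    from (Δadj⇔ (edge p q) (edge q s)) (isEdge-edge p∼q , isEdge-edge q∼s ,
                      edge-≢ (∼⇒≢ p∼q ∘ proj₁) (∼⇒≢ p∼s ∘ proj₁) ,
                      p , q , s , pqs , pq-in , edge-endpoints⁺ (λ v → OneOf v p q s) {q} {s} q∈ s∈)
    where
    p∈ : OneOf p p q s
    p∈ = inj₁ refl
    q∈ : OneOf q p q s
    q∈ = inj₂ (inj₁ refl)
    s∈ : OneOf s p q s
    s∈ = inj₂ (inj₂ refl)
    pqs = p∼q , q∼s , p∼s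
    pq-in = edge-endpoints⁺ (λ v → OneOf v p q s) {p} {q} p∈ q∈

  Δ-degree-of-edge : ∀ {p q} → p ∼ q → ExactlyTwo (λ s → p ∼ s × q ∼ s) → Δ.degree G (edge p q) ≡ 4
  Δ-degree-of-edge {p} {q} p∼q common-neighbours =
    cnt≡length (Δadj G (edge p q)) unique-ΔVerts distinct neighbours⇔
    where
    open ExactlyTwo common-neighbours renaming (first to c; second to d)
    p∼c = proj₁ holds-first
    q∼c = proj₂ holds-first
    p∼d = proj₁ holds-second
    q∼d = proj₂ holds-second
    distinct : Unique (edge p c ∷ edge q c ∷ edge p d ∷ edge q d ∷ [])
    distinct =
      ( edge-≢ (∼⇒≢ p∼q ∘ proj₁) (∼⇒≢ p∼c ∘ proj₁)
      ∷ edge-≢ (first≢second ∘ proj₂) (∼⇒≢ p∼d ∘ proj₁)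
      ∷ edge-≢ (∼⇒≢ p∼q ∘ proj₁) (∼⇒≢ p∼d ∘ proj₁) ∷ [])
      ∷ ( edge-≢ (∼⇒≢ (∼-sym p∼q) ∘ proj₁) (∼⇒≢ q∼d ∘ proj₁)
        ∷ edge-≢ (first≢second ∘ proj₂) (∼⇒≢ q∼d ∘ proj₁) ∷ [])
      ∷ (edge-≢ (∼⇒≢ p∼q ∘ proj₁) (∼⇒≢ p∼d ∘ proj₁) ∷ [])
      ∷ [] ∷ []
    neighbours⇔ : ∀ {g} → g ∈ edge p c ∷ edge q c ∷ edge p d ∷ edge q d ∷ [] ⇔
                          (g ∈ ΔVerts G × Δadj G (edge p q) g ≡ true)
    neighbours⇔ = mk⇔ neighbour listed
      where
      neighbour : ∀ {g} → g ∈ edge p c ∷ edge q c ∷ edge p d ∷ edge q d ∷ [] →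
                  g ∈ ΔVerts G × Δadj G (edge p q) g ≡ true
      neighbour (here refl)                         = edge∈ΔVerts p∼c , proj₁ (Δadj-via p∼q p∼c q∼c)
      neighbour (there (here refl))                 = edge∈ΔVerts q∼c , proj₂ (Δadj-via p∼q p∼c q∼c)
      neighbour (there (there (here refl)))         = edge∈ΔVerts p∼d , proj₁ (Δadj-via p∼q p∼d q∼d)
      neighbour (there (there (there (here refl)))) = edge∈ΔVerts q∼d , proj₂ (Δadj-via p∼q p∼d q∼d)
      listed : ∀ {g} → g ∈ ΔVerts G × Δadj G (edge p q) g ≡ true →
               g ∈ edge p c ∷ edge q c ∷ edge p d ∷ edge q d ∷ []
      listed (_ , h) = let s , p∼s , q∼s , g≡ = Δ-neighbour p∼q h in place (only (p∼s , q∼s)) g≡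
        where
        place : ∀ {s g} → s ≡ c ⊎ s ≡ d → g ≡ edge p s ⊎ g ≡ edge q s →
                g ∈ edge p c ∷ edge q c ∷ edge p d ∷ edge q d ∷ []
        place (inj₁ refl) (inj₁ refl) = here refl
        place (inj₁ refl) (inj₂ refl) = there (here refl)
        place (inj₂ refl) (inj₁ refl) = there (there (here refl))
        place (inj₂ refl) (inj₂ refl) = there (there (there (here refl)))

  Δ-degree≡4 : (∀ {x y} → x ∼ y → common G x y ≡ 2) → ∀ e → e ∈ ΔVerts G → Δ.degree G e ≡ 4
  Δ-degree≡4 common≡2 e e∈ =
    let p , q , p∼q , e≡pq = ΔVerts-view e∈
    in subst (λ e → Δ.degree G e ≡ 4) (≡.sym e≡pq)
             (Δ-degree-of-edge p∼q (two-neighbours-in (adj G p) (common≡2 p∼q)))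

  module _ (no-K4 : K4-free) where

    Δ-common-on-triangle : ∀ {p q r} → Triangle p q r → Δ.common G (edge p q) (edge p r) ≡ 1
    Δ-common-on-triangle {p} {q} {r} (p∼q , q∼r , p∼r) =
      cnt≡length _ unique-ΔVerts ([] ∷ []) (mk⇔ on-both listed)
      where
      on-both : ∀ {g} → g ∈ edge q r ∷ [] →
                g ∈ ΔVerts G × (Δadj G (edge p q) g ∧ Δadj G (edge p r) g) ≡ true
      on-both (here refl) = edge∈ΔVerts q∼r , from ∧≡true⇔
        ( proj₂ (Δadj-via p∼q p∼r q∼r)
        , subst (λ e → Δadj G (edge p r) e ≡ true) (edge-comm (∼⇒≢ (∼-sym q∼r)))
                (proj₂ (Δadj-via p∼r p∼q (∼-sym q∼r))) )
      listed : ∀ {g} → g ∈ ΔVerts G × (Δadj G (edge p q) g ∧ Δadj G (edge p r) g) ≡ true →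
               g ∈ edge q r ∷ []
      listed {g} (_ , h) =
        let s , p∼s , q∼s , g≡ = Δ-neighbour p∼q (∧-conicalˡ (Δadj G (edge p q) g) _ h)
            t , p∼t , r∼t , g≡′ = Δ-neighbour p∼r (∧-conicalʳ (Δadj G (edge p q) g) _ h)
        in place p∼s q∼s p∼t r∼t g≡ g≡′
        where
        place : ∀ {s t g} → p ∼ s → q ∼ s → p ∼ t → r ∼ t →
                g ≡ edge p s ⊎ g ≡ edge q s → g ≡ edge p t ⊎ g ≡ edge r t → g ∈ edge q r ∷ []
        place p∼s q∼s p∼t r∼t (inj₁ refl) (inj₁ e) with edge-injective e
        ... | inj₁ (_ , refl) =
          ⊥-elim (no-K4 ((p∼q ∷ p∼r ∷ p∼s ∷ []) ∷ (q∼r ∷ q∼s ∷ []) ∷ (r∼t ∷ []) ∷ [] ∷ []))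
        ... | inj₂ (_ , refl) = ⊥-elim (∼-irrefl p∼s)
        place _ _ p∼t _ (inj₁ refl) (inj₂ e) with edge-injective e
        ... | inj₁ (refl , _) = ⊥-elim (∼-irrefl p∼r)
        ... | inj₂ (refl , _) = ⊥-elim (∼-irrefl p∼t)
        place p∼s _ _ _ (inj₂ refl) (inj₁ e) with edge-injective e
        ... | inj₁ (refl , _) = ⊥-elim (∼-irrefl p∼q)
        ... | inj₂ (_ , refl) = ⊥-elim (∼-irrefl p∼s)
        place _ _ _ _ (inj₂ refl) (inj₂ e) with edge-injective e
        ... | inj₁ (refl , _) = ⊥-elim (∼-irrefl q∼r)
        ... | inj₂ (_ , refl) = here refl

    Δ-common-of-edge : ∀ {p q f} → p ∼ q → Δadj G (edge p q) f ≡ true → Δ.common G (edge p q) f ≡ 1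
    Δ-common-of-edge {p} {q} {f} p∼q h = via-third-vertex (Δ-neighbour {g = f} p∼q h)
      where
      via-third-vertex : (∃ λ s → p ∼ s × q ∼ s × (f ≡ edge p s ⊎ f ≡ edge q s)) →
                         Δ.common G (edge p q) f ≡ 1
      via-third-vertex (s , p∼s , q∼s , inj₁ f≡ps) =
        subst (λ f → Δ.common G (edge p q) f ≡ 1) (≡.sym f≡ps) (Δ-common-on-triangle (p∼q , q∼s , p∼s))
      via-third-vertex (s , p∼s , q∼s , inj₂ f≡qs) =
        subst₂ (λ e f → Δ.common G e f ≡ 1) (edge-comm (∼⇒≢ (∼-sym p∼q))) (≡.sym f≡qs)
               (Δ-common-on-triangle (∼-sym p∼q , p∼s , q∼s))

    Δ-common≡1 : ∀ e f → e ∈ ΔVerts G → f ∈ ΔVerts G → Δadj G e f ≡ true → Δ.common G e f ≡ 1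
    Δ-common≡1 e f e∈ _ h =
      let p , q , p∼q , e≡pq = ΔVerts-view e∈
      in subst (λ e → Δ.common G e f ≡ 1) (≡.sym e≡pq)
               (Δ-common-of-edge {f = f} p∼q (subst (λ e → Δadj G e f ≡ true) e≡pq h))

-- Graphs with λ = 2 and unique wheels

module UniqueWheelGraph {n : ℕ} (G : SimpleGraph n)
  (connected : GConnected G)
  (common≡2 : ∀ {x y} → adj G x y ≡ true → common G x y ≡ 2)
  (unique-wheel : ∀ u → UniqueWheel G u) where
  open Basics G
  open Wheels G common≡2 unique-wheel
  open AntiGallai G
  module GR = ReachProperties (verts n) (adj G)
  module ΔR = ReachProperties (ΔVerts G) (Δadj G)

  no-K4 : NotComplete G → K4-free
  no-K4 not-complete {a} {b} {c} {d}
        K@((a∼b ∷ a∼c ∷ a∼d ∷ []) ∷ (b∼c ∷ b∼d ∷ []) ∷ (c∼d ∷ []) ∷ [] ∷ [])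
    = let v , w , _ , _ , v≢w , v≁w = not-complete
      in ≡false⇒≁ v≁w (AllPairs⇒adjacent K (everything v) (everything w) v≢w)
    where
    S = a ∷ b ∷ c ∷ d ∷ []
    a∈ : a ∈ S
    a∈ = here refl
    b∈ : b ∈ S
    b∈ = there (here refl)
    c∈ : c ∈ S
    c∈ = there (there (here refl))
    d∈ : d ∈ S
    d∈ = there (there (there (here refl)))
    one-of : ∀ {p q r y} → p ∈ S → q ∈ S → r ∈ S → y ≡ p ⊎ y ≡ q ⊎ y ≡ r → y ∈ S
    one-of p∈ _  _  (inj₁ refl)        = p∈
    one-of _  q∈ _  (inj₂ (inj₁ refl)) = q∈
    one-of _  _  r∈ (inj₂ (inj₂ refl)) = r∈
    closed : ∀ {x y} → x ∈ S → x ∼ y → y ∈ S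
    closed (here refl) = one-of b∈ c∈ d∈ ∘
      triangle-apex-neighbours a∼b a∼c a∼d (b∼c , c∼d , b∼d)
    closed (there (here refl)) = one-of a∈ c∈ d∈ ∘
      triangle-apex-neighbours (∼-sym a∼b) b∼c b∼d (a∼c , c∼d , a∼d)
    closed (there (there (here refl))) = one-of a∈ b∈ d∈ ∘
      triangle-apex-neighbours (∼-sym a∼c) (∼-sym b∼c) c∼d (a∼b , b∼d , a∼d)
    closed (there (there (there (here refl)))) = one-of a∈ b∈ c∈ ∘
      triangle-apex-neighbours (∼-sym a∼d) (∼-sym b∼d) (∼-sym c∼d) (a∼b , b∼c , a∼c)
    everything : ∀ v → v ∈ S
    everything v = GR.Reach-closed (_∈ S) closed (connected a v (∈-verts a) (∈-verts v)) a∈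

  spokes-connected : ∀ {u y z} → u ∼ y → u ∼ z → edge u y ΔR.⇝ edge u z
  spokes-connected {u} {y} {z} u∼y u∼z =
    let i , y≡ = neighbour-on-rim W u∼y ; j , z≡ = neighbour-on-rim W u∼z
    in subst₂ ΔR._⇝_ (cong (edge u) (≡.sym y≡)) (cong (edge u) (≡.sym z≡))
         (ΔR.Reach-trans (ΔR.Reach-sym (λ {e} {f} → Δadj-sym {e} {f}) first∈ (from-first i))
                         (from-first j))
    where
    W = proj₁ (wheel-through u∼y)
    open Wheel W
    0<m : 0 < m
    0<m = ℕₚ.<-≤-trans (s≤s z≤n) m≥3
    first-spoke : Fin n × Fin n
    first-spoke = edge u (v (fromℕ< 0<m))
    first∈ : first-spoke ∈ ΔVerts G
    first∈ = edge∈ΔVerts (spoke (fromℕ< 0<m))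
    along : ∀ t (t<m : t < m) → first-spoke ΔR.⇝ edge u (v (fromℕ< t<m))
    along zero    _     = ΔR.done
    along (suc t) 1+t<m = ΔR.Reach-snoc (along t t<m) (edge∈ΔVerts (spoke (fromℕ< 1+t<m)))
      (proj₁ (Δadj-via (spoke (fromℕ< t<m)) (spoke (fromℕ< 1+t<m))
                       (rim (fromℕ< t<m) (fromℕ< 1+t<m) (inj₁ consecutive))))
      where
      t<m = ℕₚ.<-trans (ℕₚ.n<1+n t) 1+t<m
      consecutive = trans (cong suc (Finₚ.toℕ-fromℕ< t<m)) (≡.sym (Finₚ.toℕ-fromℕ< 1+t<m))
    from-first : ∀ i → first-spoke ΔR.⇝ edge u (v i)
    from-first i = subst (λ k → first-spoke ΔR.⇝ edge u (v k))
                         (Finₚ.fromℕ<-toℕ i (Finₚ.toℕ<n i)) (along (toℕ i) (Finₚ.toℕ<n i))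

  along-path : ∀ {x z} → x GR.⇝ z → ∀ {y w} → x ∼ y → z ∼ w → edge x y ΔR.⇝ edge z w
  along-path GR.done                 x∼y x∼w = spokes-connected x∼y x∼w
  along-path (GR.hop {v = x′} _ x∼x′ r) x∼y z∼w =
    ΔR.Reach-trans (spokes-connected x∼y x∼x′)
      (subst (ΔR._⇝ _) (edge-comm (∼⇒≢ (∼-sym x∼x′))) (along-path r (∼-sym x∼x′) z∼w))

  Δ-connected : Δ.Connected G
  Δ-connected e f e∈ f∈ with ΔVerts-view e∈ | ΔVerts-view f∈
  ... | x , y , x∼y , refl | z , w , z∼w , refl =
    along-path (connected x z (∈-verts x) (∈-verts z)) x∼y z∼w

-- Neither 3 ≤ k nor the value of μ is needed.
theorem8 : ∀ {n k μ : ℕ} (G : SimpleGraph n) →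
    GConnected G →
    GStronglyRegular G n k 2 μ →
    3 ≤ k →
    (∀ u → UniqueWheel G u) →
    Δ.Connected G × Σ ℕ λ N → Σ ℕ λ k' → Σ ℕ λ l → Δ.EdgeRegular G N k' l
theorem8 G connected (not-complete , _ , (_ , _ , λ-regular) , _) _ unique-wheel =
  Δ-connected , length (ΔVerts G) , 4 , 1 , refl , Δ-degree≡4 common≡2 , Δ-common≡1 (no-K4 not-complete)
  where
  open Basics G using (∈-verts)
  open AntiGallai G using (Δ-degree≡4; Δ-common≡1)
  common≡2 : ∀ {x y} → adj G x y ≡ true → common G x y ≡ 2
  common≡2 {x} {y} = λ-regular x y (∈-verts x) (∈-verts y)
  open UniqueWheelGraph G connected common≡2 unique-wheel using (no-K4; Δ-connected)
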